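{- Let $C$ be an $\mathrm{HFP}$-code of length $4n$ whose group of associated permutations $\Pi=\{\pi_{\mathbf{x}}:\mathbf{x}\in C\}$ is cyclic of order $4n$, i.e. an $\mathrm{HFP}$-code of type $C_{4n}\times C_2$ where the factor $C_2$ is generated by the all-ones vector $\mathbf{u}$. Then $C$ is a circulant Hadamard code of length $4n$.
   Context: $\mathbb{F}_2$ is the binary field; vectors of $\mathbb{F}_2^{4n}$ are identified with polynomials in $\mathbb{F}_2[x]/(x^{4n}-1)$, multiplication by $x$ being a cyclic shift; $\mathbf{u}=1+x+\dots+x^{4n-1}$. A circulant Hadamard matrix of order $4n$ is a $4n\times 4n$ $\{\pm1\}$-matrix whose rows are a vector and its successive cyclic shifts, with $HH^T=4nI$; its binary generator polynomial $g$ has coefficient $0$ where the first row has $1$ and $1$ where it has $-1$. A circulant Hadamard code of length $4n$ is the binary code $\{g+x^ig,\ \mathbf{u}+g+x^ig : 0\le i\le 4n-1\}$ where $g$ is the binary generator polynomial of a circulant Hadamard matrix of order $4n$ (up to the identification of the coordinate cyclic structure). A binary Hadamard code of length $4n$: from a normalized Hadamard matrix, replace $+1$ by $0$, $-1$ by $1$, and take rows and their complements. A binary code $C$ is propelinear if for each $\mathbf{x}\in C$ there is a coordinate permutation $\pi_{\mathbf{x}}$ with $\mathbf{x}+\pi_{\mathbf{x}}(\mathbf{y})\in C$ and $\pi_{\mathbf{x}}\pi_{\mathbf{y}}=\pi_{\mathbf{x}+\pi_{\mathbf{x}}(\mathbf{y})}$ for all $\mathbf{y}\in C$; then $\mathbf{x}*\mathbf{y}=\mathbf{x}+\pi_{\mathbf{x}}(\mathbf{y})$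 makes $C$ a group, whose isomorphism type is the type of $C$. An $\mathrm{HFP}$-code is a propelinear Hadamard code with $\pi_{\mathbf{0}}=\pi_{\mathbf{u}}=\mathrm{id}$ and $\pi_{\mathbf{a}}$ fixed-point-free for every $\mathbf{a}\in C\setminus\{\mathbf{0},\mathbf{u}\}$. -}

module Defs where

open import Data.Nat using (ℕ; zero; suc; _+_; _*_; _∸_; _%_; _<_; NonZero)
open import Data.Nat.DivMod using (_mod_)
open import Data.Bool using (Bool; true; false; _xor_; not; if_then_else_)
open import Data.Fin using (Fin; toℕ)
import Data.Fin
import Data.Unit
open import Data.Fin.Permutation using (Permutation′; _⟨$⟩ʳ_; _⟨$⟩ˡ_)
open import Data.Vec using (Vec; lookup; tabulate; replicate)
open import Data.Integer using (ℤ; +_; -_; _≟_) renaming (_+_ to _+ℤ_; _*_ to _*ℤ_)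
open import Data.Product using (Σ; ∃; _×_; _,_)
open import Data.Sum using (_⊎_)
open import Relation.Nullary using (¬_; does)
open import Relation.Binary.PropositionalEquality using (_≡_; _≢_)
open import Function.Bundles using (_⇔_)

-- Binary words of length N, identified with F₂[x]/(x^N − 1)

Word : ℕ → Set
Word N = Vec Bool N

_⊕_ : ∀ {N} → Word N → Word N → Word N
_⊕_ {N} v w = tabulate (λ i → lookup v i xor lookup w i)

𝟎 : ∀ {N} → Word N
𝟎 {N} = replicate N false

𝐮 : ∀ {N} → Word N
𝐮 {N} = replicate N true

-- (x^k · w)_j = w_{(j - k) mod N}  : multiplication by x^k = cyclic shift by k
shiftIdx : ∀ {N} .{{_ : NonZero N}} → ℕ → Fin N → Fin N
shiftIdx {N} k j = (toℕ j + (N ∸ (k % N))) mod N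

xpow : ∀ {N} .{{_ : NonZero N}} → ℕ → Word N → Word N
xpow k w = tabulate (λ j → lookup w (shiftIdx k j))

Code : ℕ → Set₁
Code N = Word N → Set

-- action of a coordinate permutation on a word: (π w)_{π(i)} = w_i
act : ∀ {N} → Permutation′ N → Word N → Word N
act π w = tabulate (λ i → lookup w (π ⟨$⟩ˡ i))

_≈ₚ_ : ∀ {N} → Permutation′ N → Permutation′ N → Set
π ≈ₚ ρ = ∀ i → π ⟨$⟩ʳ i ≡ ρ ⟨$⟩ʳ i

IsIdentity : ∀ {N} → Permutation′ N → Set
IsIdentity π = ∀ i → π ⟨$⟩ʳ i ≡ i

FixedPointFree : ∀ {N} → Permutation′ N → Set
FixedPointFree π = ∀ i → π ⟨$⟩ʳ i ≢ i

powₚ : ∀ {N} → Permutation′ N → ℕ → Fin N → Fin N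
powₚ π zero i = i
powₚ π (suc k) i = π ⟨$⟩ʳ (powₚ π k i)

sumFin : ∀ N → (Fin N → ℤ) → ℤ
sumFin zero f = + 0
sumFin (suc N) f = f Fin.zero +ℤ sumFin N (λ i → f (Fin.suc i))

Matrix : ℕ → Set
Matrix N = Fin N → Fin N → ℤ

IsHadamard : ∀ N → Matrix N → Set
IsHadamard N H =
  (∀ i j → H i j ≡ + 1 ⊎ H i j ≡ - (+ 1)) ×
  (∀ i k → sumFin N (λ j → H i j *ℤ H k j) ≡ (if does (Data.Fin._≟_ i k) then + N else + 0))

IsNormalized : ∀ {N} → Matrix N → Set
IsNormalized {zero} H = Data.Unit.⊤
IsNormalized {suc N} H = (∀ j → H Fin.zero j ≡ + 1) × (∀ i → H i Fin.zero ≡ + 1)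

toBit : ℤ → Bool
toBit z = not (does (z ≟ + 1))

rowWord : ∀ {N} → Matrix N → Fin N → Word N
rowWord H i = tabulate (λ j → toBit (H i j))

HadamardCodeOf : ∀ {N} → Matrix N → Code N
HadamardCodeOf {N} H w = ∃ λ (i : Fin N) → w ≡ rowWord H i ⊎ w ≡ 𝐮 ⊕ rowWord H i

IsHadamardCode : ∀ N → Code N → Set
IsHadamardCode N C = ∃ λ (H : Matrix N) → IsHadamard N H × IsNormalized H ×
  (∀ w → C w ⇔ HadamardCodeOf H w)

sign : Bool → ℤ
sign false = + 1
sign true = - (+ 1)

circulant : ∀ {N} .{{_ : NonZero N}} → Word N → Matrix N
circulant g i j = sign (lookup g (shiftIdx (toℕ i) j))

IsCirculantHadamardGenerator : ∀ N .{{_ : NonZero N}} → Word N → Set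
IsCirculantHadamardGenerator N g = IsHadamard N (circulant g)

CirculantCodeOf : ∀ {N} .{{_ : NonZero N}} → Word N → Code N
CirculantCodeOf {N} g w = ∃ λ (i : Fin N) →
  w ≡ g ⊕ xpow (toℕ i) g ⊎ w ≡ 𝐮 ⊕ (g ⊕ xpow (toℕ i) g)

IsCirculantHadamardCode : ∀ N .{{_ : NonZero N}} → Code N → Set
IsCirculantHadamardCode N C = ∃ λ (g : Word N) → ∃ λ (σ : Permutation′ N) →
  IsCirculantHadamardGenerator N g × (∀ w → C w ⇔ CirculantCodeOf g (act σ w))

-- π assigns to each word x the permutation π_x (only values on C matter)
IsPropelinear : ∀ {N} → Code N → (Word N → Permutation′ N) → Set
IsPropelinear C π = ∀ x y → C x → C y →
  C (x ⊕ act (π x) y) × (∀ i → π x ⟨$⟩ʳ (π y ⟨$⟩ʳ i) ≡ π (x ⊕ act (π x) y) ⟨$⟩ʳ i)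

IsHFP : ∀ N → Code N → (Word N → Permutation′ N) → Set
IsHFP N C π = IsHadamardCode N C × IsPropelinear C π ×
  IsIdentity (π 𝟎) × IsIdentity (π 𝐮) ×
  (∀ a → C a → a ≢ 𝟎 → a ≢ 𝐮 → FixedPointFree (π a))

AssocPermGroupCyclic : ∀ N → Code N → (Word N → Permutation′ N) → Set
AssocPermGroupCyclic N C π = ∃ λ (ρ : Permutation′ N) →
  (∀ x → C x → ∃ λ (k : ℕ) → ∀ i → π x ⟨$⟩ʳ i ≡ powₚ ρ k i) ×
  (∀ k → ∃ λ (x : Word N) → C x × (∀ i → π x ⟨$⟩ʳ i ≡ powₚ ρ k i)) ×
  (∀ i → powₚ ρ N i ≡ i) ×
  (∀ k → 0 < k → k < N → ¬ (∀ i → powₚ ρ k i ≡ i))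

module Submission where

-- Let ρ generate Π and pick a codeword x with π_x = ρ.  The propelinear powers
-- p₀ = 0, p_{k+1} = x * p_k = x + π_x(p_k) are codewords with π_{p_k} = ρᵏ.  Since
-- π_y is fixed-point-free for y ∉ {0, u}, the orbit map n ↦ ρⁿ(0) is a bijection
-- of the N coordinates; relabelling coordinates along this orbit turns ρ into the
-- cyclic shift.  Reading x along the orbit gives bits X(n), and unfolding the
-- recursion yields p_k(ρ^{n+k}(0)) = G(n+k) + G(n) for the prefix sums
-- G(n) = X(1) + ... + X(n).  As x ∉ {0, u} is a word of a Hadamard code of length
-- 4n it is balanced, hence of even weight, so G is N-periodic; with
-- g = (G(0), ..., G(N-1)) every relabelled p_k equals g + xᵏg.  The circulant
-- matrix of g is Hadamard: after reindexing along the orbit, rows a < b multiply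
-- to the ±1-sum of the balanced codeword p_{b-a}.  Finally a codeword is
-- determined up to complement by its permutation, so C = {p_k, u + p_k}.

open import Defs
open import Data.Nat using (ℕ; zero; suc; _*_; _+_; _∸_; _%_; _/_; _<_; _≤_; z≤n; s≤s; NonZero)
import Data.Nat.Properties as ℕP
open import Algebra.Properties.CommutativeSemigroup ℕP.+-commutativeSemigroup using (x∙yz≈y∙xz)
open import Data.Nat.DivMod using (m≡m%n+[m/n]*n; [m+kn]%n≡m%n; m%n<n; m<n⇒m%n≡m; m%n%n≡m%n; m*n%n≡0; _mod_)
open import Data.Bool using (Bool; true; false; _xor_; not; if_then_else_)
open import Data.Bool.Properties using (xor-assoc; xor-comm; xor-same; true-xor; not-involutive)
open import Data.Fin using (Fin; toℕ; zero; suc; punchOut)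
import Data.Fin.Properties as FinP
open import Data.Fin.Permutation using (Permutation′; _⟨$⟩ʳ_; _⟨$⟩ˡ_; permutation; inverseˡ; inverseʳ; flip)
open import Data.Vec using (Vec; lookup; tabulate)
open import Data.Vec.Properties using (lookup∘tabulate; tabulate∘lookup; tabulate-cong; lookup-replicate; ≡-dec)
open import Data.Integer using (ℤ; +_; -_) renaming (_+_ to _+ℤ_; _*_ to _*ℤ_)
import Data.Integer.Properties as ℤP
open import Data.Integer.Solver using (module +-*-Solver)
import Algebra.Properties.CommutativeMonoid.Sum as CommutativeMonoidSum
open import Data.Product using (∃; _×_; _,_; proj₁; proj₂)
open import Data.Sum using (_⊎_; inj₁; inj₂)
open import Data.Empty using (⊥-elim)
open import Relation.Nullary using (¬_; yes; no; does)
open import Relation.Binary.PropositionalEquality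
open import Relation.Binary.Definitions using (tri<; tri≈; tri>)
open import Function.Bundles using (_⇔_; mk⇔; Equivalence)

open ≡-Reasoning

vec-ext : ∀ {A : Set} {N} {v w : Vec A N} → (∀ i → lookup v i ≡ lookup w i) → v ≡ w
vec-ext {v = v} {w} p = trans (sym (tabulate∘lookup v)) (trans (tabulate-cong p) (tabulate∘lookup w))

lookup-⊕ : ∀ {N} (v w : Word N) i → lookup (v ⊕ w) i ≡ (lookup v i xor lookup w i)
lookup-⊕ v w i = lookup∘tabulate _ i

lookup-𝟎 : ∀ {N} i → lookup (𝟎 {N}) i ≡ false
lookup-𝟎 i = lookup-replicate i false

lookup-𝐮 : ∀ {N} i → lookup (𝐮 {N}) i ≡ true
lookup-𝐮 i = lookup-replicate i true

lookup-𝐮⊕ : ∀ {N} (w : Word N) i → lookup (𝐮 ⊕ w) i ≡ not (lookup w i)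
lookup-𝐮⊕ w i = trans (lookup-⊕ 𝐮 w i) (trans (cong (_xor lookup w i) (lookup-𝐮 i)) (true-xor (lookup w i)))

lookup-act : ∀ {N} (σ : Permutation′ N) w i → lookup (act σ w) i ≡ lookup w (σ ⟨$⟩ˡ i)
lookup-act σ w i = lookup∘tabulate _ i

IsConstant : ∀ {N} → Word N → Set
IsConstant w = w ≡ 𝟎 ⊎ w ≡ 𝐮

constant-value : ∀ {N} {c : Word N} → IsConstant c → ∃ λ b → ∀ i → lookup c i ≡ b
constant-value (inj₁ refl) = false , lookup-𝟎
constant-value (inj₂ refl) = true , lookup-𝐮

xor-recover : ∀ a b c → a ≡ ((a xor c) xor (b xor c)) xor b
xor-recover false false false = refl
xor-recover false false true = refl
xor-recover false true false = refl
xor-recover false true true = refl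
xor-recover true false false = refl
xor-recover true false true = refl
xor-recover true true false = refl
xor-recover true true true = refl

constant-difference : ∀ {N} (w p a : Word N) → IsConstant (w ⊕ a) → IsConstant (p ⊕ a) →
                      w ≡ p ⊎ w ≡ 𝐮 ⊕ p
constant-difference w p a cw cp with constant-value cw | constant-value cp
... | b , eb | c , ec = by-offset (b xor c) λ i → begin
      lookup w i
        ≡⟨ xor-recover (lookup w i) (lookup p i) (lookup a i) ⟩
      ((lookup w i xor lookup a i) xor (lookup p i xor lookup a i)) xor lookup p i
        ≡⟨ cong₂ (λ s t → (s xor t) xor lookup p i)
                 (trans (sym (lookup-⊕ w a i)) (eb i)) (trans (sym (lookup-⊕ p a i)) (ec i)) ⟩
      (b xor c) xor lookup p i ∎
  where
  by-offset : ∀ d → (∀ i → lookup w i ≡ d xor lookup p i) → w ≡ p ⊎ w ≡ 𝐮 ⊕ p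
  by-offset false e = inj₁ (vec-ext e)
  by-offset true e = inj₂ (vec-ext λ i → trans (e i) (sym (lookup-𝐮⊕ p i)))

inverse-cong : ∀ {N} (σ τ : Permutation′ N) → σ ≈ₚ τ → ∀ i → σ ⟨$⟩ˡ i ≡ τ ⟨$⟩ˡ i
inverse-cong σ τ e i = trans (sym (inverseˡ τ)) (cong (τ ⟨$⟩ˡ_) (trans (sym (e (σ ⟨$⟩ˡ i))) (inverseʳ σ)))

act-cong : ∀ {N} (σ τ : Permutation′ N) → σ ≈ₚ τ → ∀ w → act σ w ≡ act τ w
act-cong σ τ e w = vec-ext λ i →
  trans (lookup-act σ w i) (trans (cong (lookup w) (inverse-cong σ τ e i)) (sym (lookup-act τ w i)))

act-identity : ∀ {N} (σ : Permutation′ N) → IsIdentity σ → ∀ w → act σ w ≡ w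
act-identity σ e w = vec-ext λ i →
  trans (lookup-act σ w i) (cong (lookup w) (trans (cong (σ ⟨$⟩ˡ_) (sym (e i))) (inverseˡ σ)))

act-injective : ∀ {N} (σ : Permutation′ N) {v w} → act σ v ≡ act σ w → v ≡ w
act-injective σ {v} {w} e = vec-ext λ i → begin
  lookup v i                       ≡⟨ cong (lookup v) (sym (inverseˡ σ)) ⟩
  lookup v (σ ⟨$⟩ˡ (σ ⟨$⟩ʳ i))     ≡⟨ sym (lookup-act σ v _) ⟩
  lookup (act σ v) (σ ⟨$⟩ʳ i)      ≡⟨ cong (λ z → lookup z (σ ⟨$⟩ʳ i)) e ⟩
  lookup (act σ w) (σ ⟨$⟩ʳ i)      ≡⟨ lookup-act σ w _ ⟩
  lookup w (σ ⟨$⟩ˡ (σ ⟨$⟩ʳ i))     ≡⟨ cong (lookup w) (inverseˡ σ) ⟩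
  lookup w i                       ∎

act-complement : ∀ {N} (σ : Permutation′ N) v → act σ (𝐮 ⊕ v) ≡ 𝐮 ⊕ act σ v
act-complement σ v = vec-ext λ j → begin
  lookup (act σ (𝐮 ⊕ v)) j       ≡⟨ lookup-act σ (𝐮 ⊕ v) j ⟩
  lookup (𝐮 ⊕ v) (σ ⟨$⟩ˡ j)      ≡⟨ lookup-𝐮⊕ v _ ⟩
  not (lookup v (σ ⟨$⟩ˡ j))      ≡⟨ cong not (sym (lookup-act σ v j)) ⟩
  not (lookup (act σ v) j)       ≡⟨ sym (lookup-𝐮⊕ (act σ v) j) ⟩
  lookup (𝐮 ⊕ act σ v) j         ∎

permutation-injective : ∀ {N} (σ : Permutation′ N) {a b} → σ ⟨$⟩ʳ a ≡ σ ⟨$⟩ʳ b → a ≡ b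
permutation-injective σ e = trans (sym (inverseˡ σ)) (trans (cong (σ ⟨$⟩ˡ_) e) (inverseˡ σ))

powₚ-+ : ∀ {N} (ρ : Permutation′ N) a b i → powₚ ρ (a + b) i ≡ powₚ ρ a (powₚ ρ b i)
powₚ-+ ρ zero b i = refl
powₚ-+ ρ (suc a) b i = cong (ρ ⟨$⟩ʳ_) (powₚ-+ ρ a b i)

powₚ-injective : ∀ {N} (ρ : Permutation′ N) c {a b} → powₚ ρ c a ≡ powₚ ρ c b → a ≡ b
powₚ-injective ρ zero e = e
powₚ-injective ρ (suc c) e = powₚ-injective ρ c (permutation-injective ρ e)

Injective : ∀ {n} → (Fin n → Fin n) → Set
Injective h = ∀ {a b} → h a ≡ h b → a ≡ b

injective⇒surjective : ∀ {n} (h : Fin n → Fin n) → Injective h → ∀ y → ∃ λ x → h x ≡ y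
injective⇒surjective {suc n} h inj y with FinP.any? (λ x → h x FinP.≟ y)
... | yes hit = hit
... | no miss = ⊥-elim (ℕP.<-irrefl refl (FinP.injective⇒≤ {f = squeeze} squeeze-injective))
  where
  avoids : ∀ x → y ≢ h x
  avoids x e = miss (x , sym e)
  squeeze : Fin (suc n) → Fin n
  squeeze x = punchOut (avoids x)
  squeeze-injective : ∀ {a b} → squeeze a ≡ squeeze b → a ≡ b
  squeeze-injective {a} {b} e = inj (FinP.punchOut-injective (avoids a) (avoids b) e)

injective⇒permutation : ∀ {n} (h : Fin n → Fin n) → Injective h → Permutation′ n
injective⇒permutation h inj = permutation h preimage
  (λ y → proj₂ (injective⇒surjective h inj y))
  (λ x → inj (proj₂ (injective⇒surjective h inj (h x))))
  where
  preimage : Fin _ → Fin _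
  preimage y = proj₁ (injective⇒surjective h inj y)

module Periodic {A : Set} (N : ℕ) .{{_ : NonZero N}} (f : ℕ → A)
                (periodic : ∀ n → f (N + n) ≡ f n) where

  periodic-multiple : ∀ q r → f (r + q * N) ≡ f r
  periodic-multiple zero r = cong f (ℕP.+-identityʳ r)
  periodic-multiple (suc q) r = begin
    f (r + (N + q * N))   ≡⟨ cong f (x∙yz≈y∙xz r N (q * N)) ⟩
    f (N + (r + q * N))   ≡⟨ periodic (r + q * N) ⟩
    f (r + q * N)         ≡⟨ periodic-multiple q r ⟩
    f r                   ∎

  periodic-mod : ∀ a → f (a % N) ≡ f a
  periodic-mod a = trans (sym (periodic-multiple (a / N) (a % N))) (cong f (sym (m≡m%n+[m/n]*n a N)))

  periodic-cong : ∀ a b → a % N ≡ b % N → f a ≡ f b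
  periodic-cong a b e = trans (sym (periodic-mod a)) (trans (cong f e) (periodic-mod b))

-- Adding N ∸ (k % N) undoes a shift by k modulo N.
complement-shift : ∀ N .{{_ : NonZero N}} k → (N ∸ k % N) + k ≡ suc (k / N) * N
complement-shift N k = begin
  (N ∸ k % N) + k                      ≡⟨ cong (λ t → (N ∸ k % N) + t) (m≡m%n+[m/n]*n k N) ⟩
  (N ∸ k % N) + (k % N + k / N * N)    ≡⟨ sym (ℕP.+-assoc (N ∸ k % N) (k % N) _) ⟩
  (N ∸ k % N) + k % N + k / N * N      ≡⟨ cong (_+ k / N * N) (ℕP.m∸n+n≡m (ℕP.<⇒≤ (m%n<n k N))) ⟩
  N + k / N * N                        ∎

shift-back : ∀ N .{{_ : NonZero N}} a k → (a + (N ∸ k % N) + k) % N ≡ a % N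
shift-back N a k = trans (cong (_% N) (trans (ℕP.+-assoc a (N ∸ k % N) k) (cong (λ t → a + t) (complement-shift N k))))
                         ([m+kn]%n≡m%n a (suc (k / N)) N)

∸-telescope : ∀ {a b N} → a ≤ b → b ≤ N → (N ∸ b) + (b ∸ a) ≡ N ∸ a
∸-telescope {a} {b} {N} a≤b b≤N = trans (sym (ℕP.+-∸-assoc (N ∸ b) a≤b)) (cong (_∸ a) (ℕP.m∸n+n≡m b≤N))

toℕ-mod : ∀ N .{{_ : NonZero N}} a → toℕ (a mod N) ≡ a % N
toℕ-mod N a = FinP.toℕ-fromℕ< (m%n<n a N)

module ℤSum = CommutativeMonoidSum ℤP.+-0-commutativeMonoid

sumFin≡sum : ∀ n f → sumFin n f ≡ ℤSum.sum f
sumFin≡sum zero f = refl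
sumFin≡sum (suc n) f = cong (f zero +ℤ_) (sumFin≡sum n (λ i → f (suc i)))

sumFin-cong : ∀ n {f g : Fin n → ℤ} → (∀ i → f i ≡ g i) → sumFin n f ≡ sumFin n g
sumFin-cong n {f} {g} e = trans (sumFin≡sum n f) (trans (ℤSum.sum-cong-≋ e) (sym (sumFin≡sum n g)))

sumFin-reindex : ∀ n (h : Fin n → Fin n) → Injective h → ∀ f → sumFin n (λ i → f (h i)) ≡ sumFin n f
sumFin-reindex n h inj f = begin
  sumFin n (λ i → f (h i))   ≡⟨ sumFin≡sum n _ ⟩
  ℤSum.sum (λ i → f (h i))   ≡⟨ sym (ℤSum.sum-permute f (injective⇒permutation h inj)) ⟩
  ℤSum.sum f                 ≡⟨ sym (sumFin≡sum n f) ⟩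
  sumFin n f                 ∎

sumFin-neg : ∀ n (f : Fin n → ℤ) → sumFin n (λ i → - f i) ≡ - sumFin n f
sumFin-neg zero f = refl
sumFin-neg (suc n) f = trans (cong (- f zero +ℤ_) (sumFin-neg n (λ i → f (suc i))))
                             (sym (ℤP.neg-distrib-+ (f zero) _))

sumFin-one : ∀ n → sumFin n (λ _ → + 1) ≡ + n
sumFin-one zero = refl
sumFin-one (suc n) = cong (+ 1 +ℤ_) (sumFin-one n)

sumℕ : ℕ → (ℕ → ℤ) → ℤ
sumℕ zero h = + 0
sumℕ (suc n) h = h 0 +ℤ sumℕ n (λ l → h (suc l))

sumFin-toℕ : ∀ n (h : ℕ → ℤ) → sumFin n (λ j → h (toℕ j)) ≡ sumℕ n h
sumFin-toℕ zero h = refl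
sumFin-toℕ (suc n) h = cong (h 0 +ℤ_) (sumFin-toℕ n (λ l → h (suc l)))

sign-xor : ∀ a b → sign a *ℤ sign b ≡ sign (a xor b)
sign-xor false false = refl
sign-xor false true = refl
sign-xor true false = refl
sign-xor true true = refl

sign-not : ∀ b → sign (not b) ≡ - sign b
sign-not false = refl
sign-not true = refl

sign∘toBit : ∀ z → z ≡ + 1 ⊎ z ≡ - (+ 1) → sign (toBit z) ≡ z
sign∘toBit .(+ 1) (inj₁ refl) = refl
sign∘toBit .(- (+ 1)) (inj₂ refl) = refl

sign-±1 : ∀ b → sign b ≡ + 1 ⊎ sign b ≡ - (+ 1)
sign-±1 false = inj₁ refl
sign-±1 true = inj₂ refl

parity : ℕ → (ℕ → Bool) → Bool
parity zero h = false
parity (suc n) h = h 0 xor parity n (λ l → h (suc l))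

parity-snoc : ∀ n h → parity (suc n) h ≡ (parity n h xor h n)
parity-snoc zero h = xor-comm (h 0) false
parity-snoc (suc n) h = trans (cong (h 0 xor_) (parity-snoc n (λ l → h (suc l))))
                              (sym (xor-assoc (h 0) _ _))

bit : Bool → ℕ
bit false = 0
bit true = 1

weight : ℕ → (ℕ → Bool) → ℕ
weight zero h = 0
weight (suc n) h = bit (h 0) + weight n (λ l → h (suc l))

odd : ℕ → Bool
odd zero = false
odd (suc k) = not (odd k)

parity≡odd-weight : ∀ n h → parity n h ≡ odd (weight n h)
parity≡odd-weight zero h = refl
parity≡odd-weight (suc n) h = add-bit (h 0) (parity≡odd-weight n (λ l → h (suc l)))
  where
  add-bit : ∀ b {p c} → p ≡ odd c → (b xor p) ≡ odd (bit b + c)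
  add-bit false e = e
  add-bit true e = cong not e

odd-double : ∀ k → odd (k + k) ≡ false
odd-double zero = refl
odd-double (suc k) = trans (cong (λ t → not (odd t)) (ℕP.+-suc k k))
                           (trans (not-involutive (odd (k + k))) (odd-double k))

signed-sum+twice-weight : ∀ n h → sumℕ n (λ l → sign (h l)) +ℤ (+ 2) *ℤ (+ weight n h) ≡ + n
signed-sum+twice-weight zero h = refl
signed-sum+twice-weight (suc n) h =
  add-bit (h 0) _ _ (signed-sum+twice-weight n (λ l → h (suc l)))
  where
  open +-*-Solver
  add-bit : ∀ b s c → s +ℤ (+ 2) *ℤ (+ c) ≡ + n → (sign b +ℤ s) +ℤ (+ 2) *ℤ (+ (bit b + c)) ≡ + suc n
  add-bit false s c e = trans (ℤP.+-assoc (+ 1) s _) (cong (+ 1 +ℤ_) e)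
  add-bit true s c e = trans
    (solve 2 (λ s c → (con (- (+ 1)) :+ s) :+ con (+ 2) :* (con (+ 1) :+ c) := con (+ 1) :+ (s :+ con (+ 2) :* c)) refl s (+ c))
    (cong (+ 1 +ℤ_) e)

-- A balanced ±1 sequence of length 4k has weight 2k, hence even parity.
balanced-even : ∀ k (h : ℕ → Bool) → sumℕ (4 * k) (λ l → sign (h l)) ≡ + 0 → parity (4 * k) h ≡ false
balanced-even k h balanced = begin
  parity (4 * k) h        ≡⟨ parity≡odd-weight (4 * k) h ⟩
  odd (weight (4 * k) h)  ≡⟨ cong odd weight≡2k ⟩
  odd (2 * k)             ≡⟨ cong (λ t → odd (k + t)) (ℕP.+-identityʳ k) ⟩
  odd (k + k)             ≡⟨ odd-double k ⟩
  false                   ∎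
  where
  twice-weight : (+ 2) *ℤ (+ weight (4 * k) h) ≡ + (4 * k)
  twice-weight = trans (sym (ℤP.+-identityˡ ((+ 2) *ℤ (+ weight (4 * k) h))))
    (trans (cong (_+ℤ (+ 2) *ℤ (+ weight (4 * k) h)) (sym balanced)) (signed-sum+twice-weight (4 * k) h))
  weight≡2k : weight (4 * k) h ≡ 2 * k
  weight≡2k = ℕP.*-cancelˡ-≡ (weight (4 * k) h) (2 * k) 2
    (trans (ℤP.+-injective (trans (ℤP.pos-* 2 (weight (4 * k) h)) twice-weight)) (ℕP.*-assoc 2 2 k))

module HadamardCode {M : ℕ} {C : Code (suc M)} (hadamard : IsHadamardCode (suc M) C) where

  private
    N : ℕ
    N = suc M

    H : Matrix N
    H = proj₁ hadamard

    entries-±1 : ∀ i j → H i j ≡ + 1 ⊎ H i j ≡ - (+ 1)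
    entries-±1 = proj₁ (proj₁ (proj₂ hadamard))

    orthogonal : ∀ i k → sumFin N (λ j → H i j *ℤ H k j) ≡ (if does (i Data.Fin.≟ k) then + N else + 0)
    orthogonal = proj₂ (proj₁ (proj₂ hadamard))

    first-row : ∀ j → H zero j ≡ + 1
    first-row = proj₁ (proj₁ (proj₂ (proj₂ hadamard)))

    rows : ∀ w → C w ⇔ HadamardCodeOf H w
    rows = proj₂ (proj₂ (proj₂ hadamard))

    row₀≡𝟎 : rowWord H zero ≡ 𝟎
    row₀≡𝟎 = vec-ext λ j → trans (lookup∘tabulate (λ j → toBit (H zero j)) j) (trans (cong toBit (first-row j)) (sym (lookup-𝟎 j)))

    row₀-complement : 𝐮 ⊕ rowWord H zero ≡ 𝐮
    row₀-complement = vec-ext λ j → trans (lookup-𝐮⊕ (rowWord H zero) j)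
      (trans (cong (λ w → not (lookup w j)) row₀≡𝟎) (trans (cong not (lookup-𝟎 j)) (sym (lookup-𝐮 j))))

    sign-row : ∀ i j → sign (lookup (rowWord H i) j) ≡ H i j *ℤ H zero j
    sign-row i j = trans (cong sign (lookup∘tabulate (λ j → toBit (H i j)) j))
      (trans (sign∘toBit (H i j) (entries-±1 i j))
             (sym (trans (cong (H i j *ℤ_) (first-row j)) (ℤP.*-identityʳ _))))

  𝟎∈C : C 𝟎
  𝟎∈C = Equivalence.from (rows 𝟎) (zero , inj₁ (sym row₀≡𝟎))

  𝐮∈C : C 𝐮
  𝐮∈C = Equivalence.from (rows 𝐮) (zero , inj₂ (sym row₀-complement))

  -- Every codeword other than 𝟎 and 𝐮 is balanced: it is orthogonal to row 0.
  balanced : ∀ c → C c → c ≢ 𝟎 → c ≢ 𝐮 → sumFin N (λ j → sign (lookup c j)) ≡ + 0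
  balanced c c∈C c≢𝟎 c≢𝐮 with Equivalence.to (rows c) c∈C
  ... | zero , inj₁ e = ⊥-elim (c≢𝟎 (trans e row₀≡𝟎))
  ... | zero , inj₂ e = ⊥-elim (c≢𝐮 (trans e row₀-complement))
  ... | suc i , inj₁ refl = trans (sumFin-cong N (sign-row (suc i))) (orthogonal (suc i) zero)
  ... | suc i , inj₂ refl = begin
    sumFin N (λ j → sign (lookup (𝐮 ⊕ rowWord H (suc i)) j))
      ≡⟨ sumFin-cong N (λ j → trans (cong sign (lookup-𝐮⊕ (rowWord H (suc i)) j))
                                    (trans (sign-not (lookup (rowWord H (suc i)) j)) (cong -_ (sign-row (suc i) j)))) ⟩
    sumFin N (λ j → - (H (suc i) j *ℤ H zero j))
      ≡⟨ sumFin-neg N (λ j → H (suc i) j *ℤ H zero j) ⟩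
    - sumFin N (λ j → H (suc i) j *ℤ H zero j)
      ≡⟨ cong -_ (orthogonal (suc i) zero) ⟩
    + 0 ∎

module PropelinearPowers {N} {C : Code N} {π : Word N → Permutation′ N}
  (propelinear : IsPropelinear C π) (π𝟎 : IsIdentity (π 𝟎)) (𝟎∈C : C 𝟎)
  {x : Word N} (x∈C : C x) {ρ : Permutation′ N} (πx≈ρ : π x ≈ₚ ρ) where

  power : ℕ → Word N
  power zero = 𝟎
  power (suc k) = x ⊕ act (π x) (power k)

  power∈C : ∀ k → C (power k)
  power∈C zero = 𝟎∈C
  power∈C (suc k) = proj₁ (propelinear x (power k) x∈C (power∈C k))

  power-perm : ∀ k i → π (power k) ⟨$⟩ʳ i ≡ powₚ ρ k i
  power-perm zero i = π𝟎 i
  power-perm (suc k) i = begin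
    π (power (suc k)) ⟨$⟩ʳ i           ≡⟨ sym (proj₂ (propelinear x (power k) x∈C (power∈C k)) i) ⟩
    π x ⟨$⟩ʳ (π (power k) ⟨$⟩ʳ i)      ≡⟨ πx≈ρ _ ⟩
    ρ ⟨$⟩ʳ (π (power k) ⟨$⟩ʳ i)        ≡⟨ cong (ρ ⟨$⟩ʳ_) (power-perm k i) ⟩
    powₚ ρ (suc k) i                    ∎

  power-step : ∀ k i → lookup (power (suc k)) (ρ ⟨$⟩ʳ i) ≡ (lookup x (ρ ⟨$⟩ʳ i) xor lookup (power k) i)
  power-step k i = trans (lookup-⊕ x (act (π x) (power k)) (ρ ⟨$⟩ʳ i)) (cong (lookup x (ρ ⟨$⟩ʳ i) xor_) (begin
    lookup (act (π x) (power k)) (ρ ⟨$⟩ʳ i)     ≡⟨ lookup-act (π x) (power k) (ρ ⟨$⟩ʳ i) ⟩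
    lookup (power k) (π x ⟨$⟩ˡ (ρ ⟨$⟩ʳ i))      ≡⟨ cong (λ j → lookup (power k) (π x ⟨$⟩ˡ j)) (sym (πx≈ρ i)) ⟩
    lookup (power k) (π x ⟨$⟩ˡ (π x ⟨$⟩ʳ i))    ≡⟨ cong (lookup (power k)) (inverseˡ (π x)) ⟩
    lookup (power k) i                           ∎))

module CyclicHFP {M : ℕ} (C : Code (suc M)) (π : Word (suc M) → Permutation′ (suc M))
  (hfp : IsHFP (suc M) C π) (cyclic : AssocPermGroupCyclic (suc M) C π) where

  N : ℕ
  N = suc M

  open HadamardCode (proj₁ hfp)

  private
    propelinear : IsPropelinear C π
    propelinear = proj₁ (proj₂ hfp)

    π𝟎 : IsIdentity (π 𝟎)
    π𝟎 = proj₁ (proj₂ (proj₂ hfp))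

    π𝐮 : IsIdentity (π 𝐮)
    π𝐮 = proj₁ (proj₂ (proj₂ (proj₂ hfp)))

    fixed-point-free : ∀ a → C a → a ≢ 𝟎 → a ≢ 𝐮 → FixedPointFree (π a)
    fixed-point-free = proj₂ (proj₂ (proj₂ (proj₂ hfp)))

    ρ : Permutation′ N
    ρ = proj₁ cyclic

    perm-is-power : ∀ w → C w → ∃ λ k → ∀ i → π w ⟨$⟩ʳ i ≡ powₚ ρ k i
    perm-is-power = proj₁ (proj₂ cyclic)

    power-is-perm : ∀ k → ∃ λ w → C w × (∀ i → π w ⟨$⟩ʳ i ≡ powₚ ρ k i)
    power-is-perm = proj₁ (proj₂ (proj₂ cyclic))

    ρ-order : ∀ i → powₚ ρ N i ≡ i
    ρ-order = proj₁ (proj₂ (proj₂ (proj₂ cyclic)))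

    ρ-minimal : ∀ k → 0 < k → k < N → ¬ (∀ i → powₚ ρ k i ≡ i)
    ρ-minimal = proj₂ (proj₂ (proj₂ (proj₂ cyclic)))

  -- A codeword with identity permutation is constant, as π_a has no fixed point otherwise.
  identity-perm⇒constant : ∀ y → C y → IsIdentity (π y) → IsConstant y
  identity-perm⇒constant y y∈C e with ≡-dec Data.Bool._≟_ y 𝟎 | ≡-dec Data.Bool._≟_ y 𝐮
  ... | yes y≡𝟎 | _ = inj₁ y≡𝟎
  ... | no _ | yes y≡𝐮 = inj₂ y≡𝐮
  ... | no y≢𝟎 | no y≢𝐮 = ⊥-elim (fixed-point-free y y∈C y≢𝟎 y≢𝐮 zero (e zero))

  -- A codeword with permutation ρᵈ, 0 < d < N, is not constant, since π_𝟎 = π_𝐮 = id.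
  nonconstant : ∀ y d → (∀ i → π y ⟨$⟩ʳ i ≡ powₚ ρ d i) → 0 < d → d < N → y ≢ 𝟎 × y ≢ 𝐮
  nonconstant y d e 0<d d<N =
      (λ y≡𝟎 → ρ-minimal d 0<d d<N (λ i → trans (sym (e i)) (trans (cong (λ w → π w ⟨$⟩ʳ i) y≡𝟎) (π𝟎 i))))
    , (λ y≡𝐮 → ρ-minimal d 0<d d<N (λ i → trans (sym (e i)) (trans (cong (λ w → π w ⟨$⟩ʳ i) y≡𝐮) (π𝐮 i))))

  module ρ-Periodic (i : Fin N) =
    Periodic N (λ n → powₚ ρ n i) (λ n → trans (powₚ-+ ρ N n i) (ρ-order (powₚ ρ n i)))

  orbit : ℕ → Fin N
  orbit n = powₚ ρ n zero

  orbit-periodic : ∀ n → orbit (N + n) ≡ orbit n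
  orbit-periodic n = trans (powₚ-+ ρ N n zero) (ρ-order (orbit n))

  module OrbitPeriodic = Periodic N orbit orbit-periodic

  -- Within one period the orbit does not repeat: ρ^{b-a} would fix orbit a.
  orbit-distinct : ∀ a b → a < b → b < N → orbit a ≢ orbit b
  orbit-distinct a b a<b b<N repeat with power-is-perm (b ∸ a)
  ... | y , y∈C , πy≈ρᵈ = fixed-point-free y y∈C (proj₁ nt) (proj₂ nt) (orbit a) (begin
      π y ⟨$⟩ʳ orbit a       ≡⟨ πy≈ρᵈ (orbit a) ⟩
      powₚ ρ (b ∸ a) (orbit a) ≡⟨ sym (powₚ-+ ρ (b ∸ a) a zero) ⟩
      orbit (b ∸ a + a)      ≡⟨ cong orbit (ℕP.m∸n+n≡m (ℕP.<⇒≤ a<b)) ⟩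
      orbit b                ≡⟨ sym repeat ⟩
      orbit a                ∎)
    where
    nt : y ≢ 𝟎 × y ≢ 𝐮
    nt = nonconstant y (b ∸ a) πy≈ρᵈ (ℕP.m<n⇒0<n∸m a<b) (ℕP.≤-<-trans (ℕP.m∸n≤m b a) b<N)

  orbitᶠ : Fin N → Fin N
  orbitᶠ i = orbit (toℕ i)

  orbitᶠ-injective : Injective orbitᶠ
  orbitᶠ-injective {a} {b} e with ℕP.<-cmp (toℕ a) (toℕ b)
  ... | tri< a<b _ _ = ⊥-elim (orbit-distinct (toℕ a) (toℕ b) a<b (FinP.toℕ<n b) e)
  ... | tri≈ _ a≡b _ = FinP.toℕ-injective a≡b
  ... | tri> _ _ b<a = ⊥-elim (orbit-distinct (toℕ b) (toℕ a) b<a (FinP.toℕ<n a) (sym e))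

  -- Relabelling along the orbit: coordinate j of the new word is coordinate ρʲ(0).
  relabel : Permutation′ N
  relabel = flip (injective⇒permutation orbitᶠ orbitᶠ-injective)

  lookup-relabel : ∀ w j → lookup (act relabel w) j ≡ lookup w (orbitᶠ j)
  lookup-relabel w j = lookup-act relabel w j

  x : Word N
  x = proj₁ (power-is-perm 1)

  x∈C : C x
  x∈C = proj₁ (proj₂ (power-is-perm 1))

  πx≈ρ : π x ≈ₚ ρ
  πx≈ρ = proj₂ (proj₂ (power-is-perm 1))

  open PropelinearPowers {C = C} {π = π} propelinear π𝟎 𝟎∈C {x = x} x∈C {ρ = ρ} πx≈ρ

  power-balanced : ∀ d → 0 < d → d < N → sumFin N (λ j → sign (lookup (power d) j)) ≡ + 0
  power-balanced d 0<d d<N = balanced (power d) (power∈C d) (proj₁ nt) (proj₂ nt)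
    where
    nt : power d ≢ 𝟎 × power d ≢ 𝐮
    nt = nonconstant (power d) d (power-perm d) 0<d d<N

  𝐮⊕power∈C : ∀ k → C (𝐮 ⊕ power k)
  𝐮⊕power∈C k = subst C (cong (𝐮 ⊕_) (act-identity (π 𝐮) π𝐮 (power k)))
                        (proj₁ (propelinear 𝐮 (power k) 𝐮∈C (power∈C k)))

  -- A codeword is determined up to complement by its permutation: multiplying
  -- by the inverse power p_{N-k} yields constant words in both cases.
  same-permutation⇒same-coset : ∀ w v k → C w → C v →
    (∀ i → π w ⟨$⟩ʳ i ≡ powₚ ρ k i) → (∀ i → π v ⟨$⟩ʳ i ≡ powₚ ρ k i) → w ≡ v ⊎ w ≡ 𝐮 ⊕ v
  same-permutation⇒same-coset w v k w∈C v∈C πw≈ρᵏ πv≈ρᵏ =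
    constant-difference w v (act (π v) inverse)
      (subst (λ a → IsConstant (w ⊕ a)) (act-cong (π w) (π v) (λ i → trans (πw≈ρᵏ i) (sym (πv≈ρᵏ i))) inverse)
             (times-inverse-constant w w∈C πw≈ρᵏ))
      (times-inverse-constant v v∈C πv≈ρᵏ)
    where
    inverse : Word N
    inverse = power (N ∸ k % N)

    ρᵏ-inverse : ∀ i → powₚ ρ (k + (N ∸ k % N)) i ≡ i
    ρᵏ-inverse i = ρ-Periodic.periodic-cong i (k + (N ∸ k % N)) 0 (begin
      (k + (N ∸ k % N)) % N      ≡⟨ cong (_% N) (trans (ℕP.+-comm k _) (complement-shift N k)) ⟩
      (suc (k / N) * N) % N      ≡⟨ m*n%n≡0 (suc (k / N)) N ⟩
      0                          ∎)

    times-inverse-constant : ∀ y → C y → (∀ i → π y ⟨$⟩ʳ i ≡ powₚ ρ k i) → IsConstant (y ⊕ act (π y) inverse)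
    times-inverse-constant y y∈C πy≈ρᵏ = identity-perm⇒constant _ (proj₁ product) λ i → begin
      π (y ⊕ act (π y) inverse) ⟨$⟩ʳ i        ≡⟨ sym (proj₂ product i) ⟩
      π y ⟨$⟩ʳ (π inverse ⟨$⟩ʳ i)             ≡⟨ πy≈ρᵏ _ ⟩
      powₚ ρ k (π inverse ⟨$⟩ʳ i)             ≡⟨ cong (powₚ ρ k) (power-perm (N ∸ k % N) i) ⟩
      powₚ ρ k (powₚ ρ (N ∸ k % N) i)         ≡⟨ sym (powₚ-+ ρ k (N ∸ k % N) i) ⟩
      powₚ ρ (k + (N ∸ k % N)) i              ≡⟨ ρᵏ-inverse i ⟩
      i                                       ∎
      where
      product : C (y ⊕ act (π y) inverse) × (∀ i → π y ⟨$⟩ʳ (π inverse ⟨$⟩ʳ i) ≡ π (y ⊕ act (π y) inverse) ⟨$⟩ʳ i)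
      product = propelinear y inverse y∈C (power∈C (N ∸ k % N))

  codeword-is-power : ∀ w → C w → ∃ λ k → w ≡ power k ⊎ w ≡ 𝐮 ⊕ power k
  codeword-is-power w w∈C with perm-is-power w w∈C
  ... | k , πw≈ρᵏ = k , same-permutation⇒same-coset w (power k) k w∈C (power∈C k) πw≈ρᵏ (power-perm k)

  X : ℕ → Bool
  X n = lookup x (orbit n)

  prefix : ℕ → Bool
  prefix zero = false
  prefix (suc n) = prefix n xor X (suc n)

  power-along-orbit : ∀ k n → lookup (power k) (orbit (n + k)) ≡ (prefix (n + k) xor prefix n)
  power-along-orbit zero n = begin
    lookup 𝟎 (orbit (n + 0))         ≡⟨ lookup-𝟎 (orbit (n + 0)) ⟩
    false                            ≡⟨ sym (xor-same (prefix n)) ⟩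
    prefix n xor prefix n            ≡⟨ cong (λ t → prefix t xor prefix n) (sym (ℕP.+-identityʳ n)) ⟩
    prefix (n + 0) xor prefix n      ∎
  power-along-orbit (suc k) n = begin
    lookup (power (suc k)) (orbit (n + suc k))
      ≡⟨ cong (λ t → lookup (power (suc k)) (orbit t)) (ℕP.+-suc n k) ⟩
    lookup (power (suc k)) (ρ ⟨$⟩ʳ orbit (n + k))
      ≡⟨ power-step k (orbit (n + k)) ⟩
    X (suc (n + k)) xor lookup (power k) (orbit (n + k))
      ≡⟨ cong (X (suc (n + k)) xor_) (power-along-orbit k n) ⟩
    X (suc (n + k)) xor (prefix (n + k) xor prefix n)
      ≡⟨ sym (xor-assoc (X (suc (n + k))) (prefix (n + k)) (prefix n)) ⟩
    (X (suc (n + k)) xor prefix (n + k)) xor prefix n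
      ≡⟨ cong (_xor prefix n) (xor-comm (X (suc (n + k))) (prefix (n + k))) ⟩
    prefix (suc (n + k)) xor prefix n
      ≡⟨ cong (λ t → prefix t xor prefix n) (sym (ℕP.+-suc n k)) ⟩
    prefix (n + suc k) xor prefix n ∎

  -- For N > 1, x is balanced, hence so is its reading along the orbit (a bijection).
  generator-balanced : 1 < N → sumℕ N (λ l → sign (X l)) ≡ + 0
  generator-balanced 1<N = begin
    sumℕ N (λ l → sign (X l))                      ≡⟨ sym (sumFin-toℕ N (λ l → sign (X l))) ⟩
    sumFin N (λ j → sign (lookup x (orbitᶠ j)))    ≡⟨ sumFin-reindex N orbitᶠ orbitᶠ-injective (λ i → sign (lookup x i)) ⟩
    sumFin N (λ i → sign (lookup x i))             ≡⟨ balanced x x∈C (proj₁ nt) (proj₂ nt) ⟩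
    + 0                                            ∎
    where
    nt : x ≢ 𝟎 × x ≢ 𝐮
    nt = nonconstant x 1 πx≈ρ (s≤s z≤n) 1<N

  -- If x has even weight, the prefix sums are N-periodic and C is circulant.
  module Circulant (x-even : parity N X ≡ false) where

    X-periodic : ∀ n → X (N + n) ≡ X n
    X-periodic n = cong (lookup x) (orbit-periodic n)

    prefix≡parity : ∀ n → prefix n ≡ parity n (λ l → X (suc l))
    prefix≡parity zero = refl
    prefix≡parity (suc n) = trans (cong (_xor X (suc n)) (prefix≡parity n))
                                  (sym (parity-snoc n (λ l → X (suc l))))

    -- prefix N = X 1 + ... + X N, and X N = X 0, so this is the weight parity of x.
    prefix-N : prefix N ≡ false
    prefix-N = begin
      prefix N                      ≡⟨ cong (_xor prefix N) (sym (xor-same (X 0))) ⟩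
      (X 0 xor X 0) xor prefix N    ≡⟨ xor-assoc (X 0) (X 0) (prefix N) ⟩
      X 0 xor (X 0 xor prefix N)    ≡⟨ cong (X 0 xor_) two-readings ⟩
      X 0 xor X 0                   ≡⟨ xor-same (X 0) ⟩
      false                         ∎
      where
      two-readings : (X 0 xor prefix N) ≡ X 0
      two-readings = begin
        X 0 xor prefix N     ≡⟨ cong (X 0 xor_) (prefix≡parity N) ⟩
        parity (suc N) X     ≡⟨ parity-snoc N X ⟩
        parity N X xor X N   ≡⟨ cong₂ _xor_ x-even (trans (cong X (sym (ℕP.+-identityʳ N))) (X-periodic 0)) ⟩
        X 0                  ∎

    prefix-periodic : ∀ n → prefix (N + n) ≡ prefix n
    prefix-periodic zero = trans (cong prefix (ℕP.+-identityʳ N)) prefix-N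
    prefix-periodic (suc n) = trans (cong prefix (ℕP.+-suc N n))
      (cong₂ _xor_ (prefix-periodic n) (trans (cong X (sym (ℕP.+-suc N n))) (X-periodic (suc n))))

    module PrefixPeriodic = Periodic N prefix prefix-periodic

    g : Word N
    g = tabulate (λ i → prefix (toℕ i))

    lookup-g : ∀ j → lookup g j ≡ prefix (toℕ j)
    lookup-g j = lookup∘tabulate (λ i → prefix (toℕ i)) j

    shifted-g : ∀ k j → lookup g (shiftIdx k j) ≡ prefix (toℕ j + (N ∸ k % N))
    shifted-g k j = trans (lookup-g (shiftIdx k j))
      (trans (cong prefix (toℕ-mod N (toℕ j + (N ∸ k % N)))) (PrefixPeriodic.periodic-mod (toℕ j + (N ∸ k % N))))

    lookup-xpow-g : ∀ k j → lookup (xpow k g) j ≡ prefix (toℕ j + (N ∸ k % N))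
    lookup-xpow-g k j = trans (lookup∘tabulate (λ j → lookup g (shiftIdx k j)) j) (shifted-g k j)

    xpow-mod : ∀ k → xpow k g ≡ xpow (toℕ (k mod N)) g
    xpow-mod k = vec-ext λ j → trans (lookup-xpow-g k j)
      (trans (cong (λ r → prefix (toℕ j + (N ∸ r))) (sym residue)) (sym (lookup-xpow-g (toℕ (k mod N)) j)))
      where
      residue : toℕ (k mod N) % N ≡ k % N
      residue = trans (cong (_% N) (toℕ-mod N k)) (m%n%n≡m%n k N)

    relabel-power : ∀ k → act relabel (power k) ≡ g ⊕ xpow k g
    relabel-power k = vec-ext λ j → let t = toℕ j + (N ∸ k % N) in begin
      lookup (act relabel (power k)) j      ≡⟨ lookup-relabel (power k) j ⟩
      lookup (power k) (orbit (toℕ j))      ≡⟨ cong (lookup (power k)) (OrbitPeriodic.periodic-cong (toℕ j) (t + k) (sym (shift-back N (toℕ j) k))) ⟩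
      lookup (power k) (orbit (t + k))      ≡⟨ power-along-orbit k t ⟩
      prefix (t + k) xor prefix t           ≡⟨ cong (_xor prefix t) (PrefixPeriodic.periodic-cong (t + k) (toℕ j) (shift-back N (toℕ j) k)) ⟩
      prefix (toℕ j) xor prefix t           ≡⟨ sym (cong₂ _xor_ (lookup-g j) (lookup-xpow-g k j)) ⟩
      lookup g j xor lookup (xpow k g) j    ≡⟨ sym (lookup-⊕ g (xpow k g) j) ⟩
      lookup (g ⊕ xpow k g) j               ∎

    circulant-bit : ∀ a j → a < N → lookup g (shiftIdx a j) ≡ prefix (toℕ j + (N ∸ a))
    circulant-bit a j a<N = trans (shifted-g a j) (cong (λ r → prefix (toℕ j + (N ∸ r))) (m<n⇒m%n≡m a<N))

    -- Rows a < b are orthogonal: their product, reindexed by j ↦ ρ^{N-a}(ρʲ 0),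
    -- is the ±1-sum of the balanced codeword p_{b-a}.
    rows-orthogonal : ∀ a b → a < b → b < N →
      sumFin N (λ j → sign (prefix (toℕ j + (N ∸ a)) xor prefix (toℕ j + (N ∸ b)))) ≡ + 0
    rows-orthogonal a b a<b b<N = begin
      sumFin N (λ j → sign (prefix (toℕ j + (N ∸ a)) xor prefix (toℕ j + (N ∸ b))))
        ≡⟨ sumFin-cong N (λ j → cong sign (sym (difference-is-power j))) ⟩
      sumFin N (λ j → sign (lookup (power d) (reindex j)))
        ≡⟨ sumFin-reindex N reindex reindex-injective (λ y → sign (lookup (power d) y)) ⟩
      sumFin N (λ y → sign (lookup (power d) y))
        ≡⟨ power-balanced d (ℕP.m<n⇒0<n∸m a<b) (ℕP.≤-<-trans (ℕP.m∸n≤m b a) b<N) ⟩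
      + 0 ∎
      where
      d c : ℕ
      d = b ∸ a
      c = N ∸ a

      reindex : Fin N → Fin N
      reindex j = powₚ ρ c (orbitᶠ j)

      reindex-injective : Injective reindex
      reindex-injective e = orbitᶠ-injective (powₚ-injective ρ c e)

      difference-is-power : ∀ j → lookup (power d) (reindex j) ≡ (prefix (toℕ j + c) xor prefix (toℕ j + (N ∸ b)))
      difference-is-power j = begin
        lookup (power d) (powₚ ρ c (orbit (toℕ j)))   ≡⟨ cong (lookup (power d)) (sym (powₚ-+ ρ c (toℕ j) zero)) ⟩
        lookup (power d) (orbit (c + toℕ j))          ≡⟨ cong (λ s → lookup (power d) (orbit s)) (trans (ℕP.+-comm c (toℕ j)) (sym t+d≡j+c)) ⟩
        lookup (power d) (orbit (t + d))              ≡⟨ power-along-orbit d t ⟩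
        prefix (t + d) xor prefix t                   ≡⟨ cong (λ s → prefix s xor prefix t) t+d≡j+c ⟩
        prefix (toℕ j + c) xor prefix t               ∎
        where
        t : ℕ
        t = toℕ j + (N ∸ b)

        t+d≡j+c : t + d ≡ toℕ j + c
        t+d≡j+c = trans (ℕP.+-assoc (toℕ j) (N ∸ b) d)
                          (cong (λ s → toℕ j + s) (∸-telescope (ℕP.<⇒≤ a<b) (ℕP.<⇒≤ b<N)))

    circulant-hadamard : IsCirculantHadamardGenerator N g
    circulant-hadamard = (λ i j → sign-±1 (lookup g (shiftIdx (toℕ i) j))) , orthogonality
      where
      diagonal : ∀ i → sumFin N (λ j → circulant g i j *ℤ circulant g i j) ≡ + N
      diagonal i = trans (sumFin-cong N (λ j → let b = lookup g (shiftIdx (toℕ i) j) in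
                                         trans (sign-xor b b) (cong sign (xor-same b))))
                         (sumFin-one N)

      off-diagonal : ∀ i k → toℕ i < toℕ k → sumFin N (λ j → circulant g i j *ℤ circulant g k j) ≡ + 0
      off-diagonal i k i<k = trans
        (sumFin-cong N (λ j → trans (sign-xor (lookup g (shiftIdx (toℕ i) j)) (lookup g (shiftIdx (toℕ k) j)))
          (cong sign (cong₂ _xor_ (circulant-bit (toℕ i) j (FinP.toℕ<n i)) (circulant-bit (toℕ k) j (FinP.toℕ<n k))))))
        (rows-orthogonal (toℕ i) (toℕ k) i<k (FinP.toℕ<n k))

      orthogonality : ∀ i k → sumFin N (λ j → circulant g i j *ℤ circulant g k j) ≡ (if does (i Data.Fin.≟ k) then + N else + 0)
      orthogonality i k with i Data.Fin.≟ k
      ... | yes refl = diagonal i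
      ... | no i≢k with ℕP.<-cmp (toℕ i) (toℕ k)
      ...   | tri< i<k _ _ = off-diagonal i k i<k
      ...   | tri≈ _ i≡k _ = ⊥-elim (i≢k (FinP.toℕ-injective i≡k))
      ...   | tri> _ _ k<i = trans (sumFin-cong N (λ j → ℤP.*-comm (circulant g i j) (circulant g k j))) (off-diagonal k i k<i)

    code→circulant : ∀ w → C w → CirculantCodeOf g (act relabel w)
    code→circulant w w∈C with codeword-is-power w w∈C
    ... | k , inj₁ refl = k mod N , inj₁ (trans (relabel-power k) (cong (g ⊕_) (xpow-mod k)))
    ... | k , inj₂ refl = k mod N , inj₂ (trans (act-complement relabel (power k))
                                         (cong (𝐮 ⊕_) (trans (relabel-power k) (cong (g ⊕_) (xpow-mod k)))))

    circulant→code : ∀ w → CirculantCodeOf g (act relabel w) → C w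
    circulant→code w (i , inj₁ e) =
      subst C (act-injective relabel (trans (relabel-power (toℕ i)) (sym e))) (power∈C (toℕ i))
    circulant→code w (i , inj₂ e) =
      subst C (act-injective relabel (trans (act-complement relabel (power (toℕ i)))
                                     (trans (cong (𝐮 ⊕_) (relabel-power (toℕ i))) (sym e))))
              (𝐮⊕power∈C (toℕ i))

    circulant-code : IsCirculantHadamardCode N C
    circulant-code = g , relabel , circulant-hadamard , λ w → mk⇔ (code→circulant w) (circulant→code w)

proposition2p3 : (m : ℕ) → (C : Code (4 * suc m)) → (π : Word (4 * suc m) → Permutation′ (4 * suc m)) →
    IsHFP (4 * suc m) C π → AssocPermGroupCyclic (4 * suc m) C π →
    IsCirculantHadamardCode (4 * suc m) C
proposition2p3 m C π hfp cyclic = circulant-code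
  where
  open CyclicHFP {m + 3 * suc m} C π hfp cyclic

  -- The generator is balanced of length 4(m+1), hence has even weight.
  x-even : parity (4 * suc m) X ≡ false
  x-even = balanced-even (suc m) X (generator-balanced 1<4[m+1])
    where
    1<4[m+1] : 1 < 4 * suc m
    1<4[m+1] = s≤s (ℕP.≤-trans (s≤s z≤n) (ℕP.m≤n+m (3 * suc m) m))

  open Circulant x-even
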